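{- Let $G$ be a happy labelled sequent. Then its model $\mathcal{M}(G)=\langle \mathrm{Lab}(G), R_G, \le_G, V\rangle$ is a birelational model in which $R_G$ is reflexive and transitive (and $\le_G$ is a preorder), and for every label $x$ and formula $A$: if $x{:}A^{\bullet}$ occurs in $G$ then $x\Vdash A$ in $\mathcal{M}(G)$, and if $x{:}A^{\circ}$ occurs in $G$ then $x\not\Vdash A$ in $\mathcal{M}(G)$.
   Context: Formulas: $A ::= \bot \mid a \mid A\wedge A\mid A\vee A\mid A\supset A\mid \Box A\mid \Diamond A$ over atoms $a$. A birelational model $\langle W,R,\le,V\rangle$: $W$ nonempty, $\le$ a preorder, $R$ a relation with (F1) $xRy$, $y\le z$ implies $\exists u$: $x\le u$, $uRz$; (F2) $x\le z$, $xRy$ implies $\exists u$: $zRu$, $y\le u$; $V:W\to 2^{\mathcal{A}}$ monotone along $\le$. Forcing: $w\Vdash a$ iff $a\in V(w)$; $w\not\Vdash \bot$; $\wedge,\vee$ pointwise; $w\Vdash A\supset B$ iff for all $w'\ge w$, $w'\Vdash A$ implies $w'\Vdash B$; $w\Vdash \Box A$ iff for all $w'\ge w$ and $u$ with $w'Ru$, $u\Vdash A$; $w\Vdash\Diamond A$ iff $\exists u$ with $wRu$, $u\Vdash A$. A labelled formula is a pair $x{:}A$ of a label and a formula; a relational atom is $xRy$ or $x\le y$ for labels $x,y$. A labelled sequent $G$ is $\mathcal{R},\Gamma\Rightarrow\Delta$ with $\mathcal{R}$ a set of relational atoms and $\Gamma,\Delta$ multisets of labelled formulas. Write $x\le_G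 y$ (resp. $xR_Gy$) iff $x\le y$ (resp. $xRy$) is in $\mathcal{R}$; write $x{:}A^\bullet$ occurs in $G$ iff $x{:}A\in\Gamma$, and $x{:}A^\circ$ occurs in $G$ iff $x{:}A\in\Delta$; $\mathrm{Lab}(G)$ is the set of labels of $G$. Happiness of an occurrence at $x$: $x{:}a^\bullet$ always happy; $x{:}a^\circ$ happy iff $x{:}a^\bullet$ does not occur; $x{:}\bot^\bullet$ never happy; $x{:}\bot^\circ$ always happy; $x{:}(A\wedge B)^\bullet$ iff $x{:}A^\bullet$ and $x{:}B^\bullet$; $x{:}(A\wedge B)^\circ$ iff $x{:}A^\circ$ or $x{:}B^\circ$; $x{:}(A\vee B)^\bullet$ iff $x{:}A^\bullet$ or $x{:}B^\bullet$; $x{:}(A\vee B)^\circ$ iff $x{:}A^\circ$ and $x{:}B^\circ$; $x{:}(A\supset B)^\bullet$ iff $x{:}A^\circ$ or $x{:}B^\bullet$; $x{:}(A\supset B)^\circ$ iff $y{:}A^\bullet$ and $y{:}B^\circ$ for some $y$ with $x\le_G y$; $x{:}(\Box A)^\bullet$ iff $z{:}A^\bullet$ and $z{:}(\Box A)^\bullet$ for all $z$ with $xR_Gz$; $x{:}(\Box A)^\circ$ iff $z{:}A^\circ$ for some $y,z$ with $x\le_G y$ and $yR_Gz$; $x{:}(\Diamond A)^\bullet$ iff $y{:}A^\bullet$ for some $y$ with $xR_Gy$; $x{:}(\Diamond A)^\circ$ iff $y{:}A^\circ$ and $y{:}(\Diamond A)^\circ$ for all $y$ with $xR_Gy$ (all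 occurrences meant in $G$). A label is happy iff all formulas occurring at it are happy. $G$ is structurally saturated iff: $x\le_G y$ and $x{:}C^\bullet$ imply $y{:}C^\bullet$; $xR_Gy$ and $y\le_Gz$ imply $\exists u$: $x\le_Gu$, $uR_Gz$; $xR_Gy$ and $x\le_G z$ imply $\exists u$: $y\le_G u$, $zR_Gu$; $\le_G$ and $R_G$ are transitive; $x\le_Gx$ and $xR_Gx$ for every label $x$ of $G$. $G$ is happy iff it is structurally saturated and all its labels are happy. The model of $G$ is $\mathcal{M}(G)=\langle\mathrm{Lab}(G),R_G,\le_G,V\rangle$ with $a\in V(w)$ iff $w{:}a^\bullet$ occurs in $G$. -}

module Defs where

open import Data.Nat using (ℕ)
open import Data.Product using (Σ; ∃; ∃-syntax; _×_; _,_; proj₁; proj₂)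
open import Data.Sum using (_⊎_)
open import Data.Empty using (⊥)
open import Data.Unit using (⊤)
open import Data.List using (List)
open import Data.List.Membership.Propositional using (_∈_)
open import Relation.Nullary using (¬_)

Atom : Set
Atom = ℕ

infixr 6 _∧_
infixr 5 _∨_
infixr 4 _⊃_

data Fm : Set where
  ⊥'  : Fm
  at  : Atom → Fm
  _∧_ : Fm → Fm → Fm
  _∨_ : Fm → Fm → Fm
  _⊃_ : Fm → Fm → Fm
  □   : Fm → Fm
  ◇   : Fm → Fm

record Frame : Set₁ where
  field
    W   : Set
    R   : W → W → Set
    _≤_ : W → W → Set
    V   : W → Atom → Set

record IsBirelational (M : Frame) : Set where
  open Frame M
  field
    nonempty : W
    ≤-refl   : ∀ x → x ≤ x
    ≤-trans  : ∀ x y z → x ≤ y → y ≤ z → x ≤ z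
    F1       : ∀ x y z → R x y → y ≤ z → ∃[ u ] (x ≤ u × R u z)
    F2       : ∀ x y z → x ≤ z → R x y → ∃[ u ] (R z u × y ≤ u)
    V-mono   : ∀ x y a → x ≤ y → V x a → V y a

_⊩_ : {M : Frame} → Frame.W M → Fm → Set
_⊩_ {M} w ⊥' = ⊥
_⊩_ {M} w (at a) = Frame.V M w a
_⊩_ {M} w (A ∧ B) = (_⊩_ {M} w A) × (_⊩_ {M} w B)
_⊩_ {M} w (A ∨ B) = (_⊩_ {M} w A) ⊎ (_⊩_ {M} w B)
_⊩_ {M} w (A ⊃ B) =
  ∀ w' → Frame._≤_ M w w' → _⊩_ {M} w' A → _⊩_ {M} w' B
_⊩_ {M} w (□ A) =
  ∀ w' u → Frame._≤_ M w w' → Frame.R M w' u → _⊩_ {M} u A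
_⊩_ {M} w (◇ A) = ∃[ u ] (Frame.R M w u × _⊩_ {M} u A)

-- Labelled sequents (labels are natural numbers; multisets as lists)

Label : Set
Label = ℕ

data RelAtom : Set where
  rR  : Label → Label → RelAtom
  r≤  : Label → Label → RelAtom

LFm : Set
LFm = Label × Fm

record Sequent : Set where
  constructor _,_⇒_
  field
    rels : List RelAtom
    ante : List LFm
    succ : List LFm
open Sequent public

module _ (G : Sequent) where

  _≤G_ : Label → Label → Set
  x ≤G y = r≤ x y ∈ rels G

  _RG_ : Label → Label → Set
  x RG y = rR x y ∈ rels G

  _∶_• : Label → Fm → Set
  x ∶ A • = (x , A) ∈ ante G

  _∶_∘ : Label → Fm → Set
  x ∶ A ∘ = (x , A) ∈ succ G

  data InLab (x : Label) : Set where
    lab-R₁ : ∀ y → x RG y → InLab x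
    lab-R₂ : ∀ y → y RG x → InLab x
    lab-≤₁ : ∀ y → x ≤G y → InLab x
    lab-≤₂ : ∀ y → y ≤G x → InLab x
    lab-•  : ∀ A → x ∶ A • → InLab x
    lab-∘  : ∀ A → x ∶ A ∘ → InLab x

  Lab : Set
  Lab = Σ Label InLab

  Happy• : Label → Fm → Set
  Happy• x ⊥' = ⊥
  Happy• x (at a) = ⊤
  Happy• x (A ∧ B) = x ∶ A • × x ∶ B •
  Happy• x (A ∨ B) = x ∶ A • ⊎ x ∶ B •
  Happy• x (A ⊃ B) = x ∶ A ∘ ⊎ x ∶ B •
  Happy• x (□ A) = ∀ z → x RG z → (z ∶ A •) × (z ∶ □ A •)
  Happy• x (◇ A) = ∃[ y ] (x RG y × y ∶ A •)

  Happy∘ : Label → Fm → Set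
  Happy∘ x ⊥' = ⊤
  Happy∘ x (at a) = ¬ (x ∶ at a •)
  Happy∘ x (A ∧ B) = x ∶ A ∘ ⊎ x ∶ B ∘
  Happy∘ x (A ∨ B) = x ∶ A ∘ × x ∶ B ∘
  Happy∘ x (A ⊃ B) = ∃[ y ] (x ≤G y × y ∶ A • × y ∶ B ∘)
  Happy∘ x (□ A) = ∃[ y ] ∃[ z ] (x ≤G y × y RG z × z ∶ A ∘)
  Happy∘ x (◇ A) = ∀ y → x RG y → (y ∶ A ∘) × (y ∶ ◇ A ∘)

  HappyLabel : Label → Set
  HappyLabel x = (∀ A → x ∶ A • → Happy• x A) × (∀ A → x ∶ A ∘ → Happy∘ x A)

  record StructurallySaturated : Set where
    field
      mono•   : ∀ x y C → x ≤G y → x ∶ C • → y ∶ C •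
      sat-F1  : ∀ x y z → x RG y → y ≤G z → ∃[ u ] (x ≤G u × u RG z)
      sat-F2  : ∀ x y z → x RG y → x ≤G z → ∃[ u ] (y ≤G u × z RG u)
      ≤-trans : ∀ x y z → x ≤G y → y ≤G z → x ≤G z
      R-trans : ∀ x y z → x RG y → y RG z → x RG z
      ≤-refl  : ∀ x → InLab x → x ≤G x
      R-refl  : ∀ x → InLab x → x RG x

  Happy : Set
  Happy = StructurallySaturated × (∀ x → InLab x → HappyLabel x)

  model : Frame
  model = record
    { W   = Lab
    ; R   = λ w v → proj₁ w RG proj₁ v
    ; _≤_ = λ w v → proj₁ w ≤G proj₁ v
    ; V   = λ w a → proj₁ w ∶ at a •
    }

-- Truth lemma by simultaneous induction on the formula: happiness of an
-- occurrence hands the forcing clause exactly the witnesses it asks for.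
-- The clauses for ⊃ and □ quantify over ≤-successors, so they use that
-- antecedent formulas are inherited along ≤G (structural saturation) to
-- make the occurrence, and hence its happiness, available at the successor.
module Submission where

open import Defs
open import Data.Product using (_×_; proj₁; proj₂; _,_)
open import Data.Sum using (inj₁; inj₂)
open import Data.Empty using (⊥-elim)
open import Relation.Nullary using (¬_)

module _ {G : Sequent} where

  ≤-successor : ∀ {x y} → _≤G_ G x y → Lab G
  ≤-successor {x} {y} x≤y = y , lab-≤₂ x x≤y

  R-successor : ∀ {x y} → _RG_ G x y → Lab G
  R-successor {x} {y} xRy = y , lab-R₂ x xRy

module _ {G : Sequent} (sat : StructurallySaturated G) where
  open StructurallySaturated sat

  model-isBirelational : Lab G → IsBirelational (model G)
  model-isBirelational w = record
    { nonempty = w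
    ; ≤-refl   = λ (x , x∈) → ≤-refl x x∈
    ; ≤-trans  = λ x y z → ≤-trans (proj₁ x) (proj₁ y) (proj₁ z)
    ; F1       = λ x y z xRy y≤z →
        let (u , x≤u , uRz) = sat-F1 (proj₁ x) (proj₁ y) (proj₁ z) xRy y≤z
        in ≤-successor x≤u , x≤u , uRz
    ; F2       = λ x y z x≤z xRy →
        let (u , y≤u , zRu) = sat-F2 (proj₁ x) (proj₁ y) (proj₁ z) xRy x≤z
        in ≤-successor y≤u , zRu , y≤u
    ; V-mono   = λ x y a x≤y → mono• (proj₁ x) (proj₁ y) (at a) x≤y
    }

  model-R-refl : ∀ (w : Lab G) → Frame.R (model G) w w
  model-R-refl (x , x∈) = R-refl x x∈

  model-R-trans : ∀ (u v w : Lab G) →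
    Frame.R (model G) u v → Frame.R (model G) v w → Frame.R (model G) u w
  model-R-trans u v w = R-trans (proj₁ u) (proj₁ v) (proj₁ w)

  module _ (happy : ∀ x → InLab G x → HappyLabel G x) where

    happy• : ∀ (w : Lab G) A → _∶_• G (proj₁ w) A → Happy• G (proj₁ w) A
    happy• (x , x∈) = proj₁ (happy x x∈)

    happy∘ : ∀ (w : Lab G) A → _∶_∘ G (proj₁ w) A → Happy∘ G (proj₁ w) A
    happy∘ (x , x∈) = proj₂ (happy x x∈)

    mutual
      occurs•⇒forced : ∀ (w : Lab G) A → _∶_• G (proj₁ w) A → _⊩_ {model G} w A
      occurs•⇒forced w ⊥'      o = ⊥-elim (happy• w ⊥' o)
      occurs•⇒forced w (at a)  o = o
      occurs•⇒forced w (A ∧ B) o with happy• w (A ∧ B) o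
      ... | oA , oB = occurs•⇒forced w A oA , occurs•⇒forced w B oB
      occurs•⇒forced w (A ∨ B) o with happy• w (A ∨ B) o
      ... | inj₁ oA = inj₁ (occurs•⇒forced w A oA)
      ... | inj₂ oB = inj₂ (occurs•⇒forced w B oB)
      occurs•⇒forced w (A ⊃ B) o w' w≤w' ⊩A
        with happy• w' (A ⊃ B) (mono• (proj₁ w) (proj₁ w') (A ⊃ B) w≤w' o)
      ... | inj₁ oA∘ = ⊥-elim (occurs∘⇒unforced w' A oA∘ ⊩A)
      ... | inj₂ oB  = occurs•⇒forced w' B oB
      occurs•⇒forced w (□ A) o w' u w≤w' w'Ru =
        let o' = mono• (proj₁ w) (proj₁ w') (□ A) w≤w' o
        in occurs•⇒forced u A (proj₁ (happy• w' (□ A) o' (proj₁ u) w'Ru))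
      occurs•⇒forced w (◇ A) o with happy• w (◇ A) o
      ... | y , wRy , oA = R-successor wRy , wRy , occurs•⇒forced (R-successor wRy) A oA

      occurs∘⇒unforced : ∀ (w : Lab G) A → _∶_∘ G (proj₁ w) A → ¬ (_⊩_ {model G} w A)
      occurs∘⇒unforced w ⊥'      o ()
      occurs∘⇒unforced w (at a)  o ⊩a = happy∘ w (at a) o ⊩a
      occurs∘⇒unforced w (A ∧ B) o (⊩A , ⊩B) with happy∘ w (A ∧ B) o
      ... | inj₁ oA = occurs∘⇒unforced w A oA ⊩A
      ... | inj₂ oB = occurs∘⇒unforced w B oB ⊩B
      occurs∘⇒unforced w (A ∨ B) o (inj₁ ⊩A) = occurs∘⇒unforced w A (proj₁ (happy∘ w (A ∨ B) o)) ⊩A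
      occurs∘⇒unforced w (A ∨ B) o (inj₂ ⊩B) = occurs∘⇒unforced w B (proj₂ (happy∘ w (A ∨ B) o)) ⊩B
      occurs∘⇒unforced w (A ⊃ B) o ⊩A⊃B with happy∘ w (A ⊃ B) o
      ... | y , w≤y , oA , oB =
        let y' = ≤-successor w≤y
        in occurs∘⇒unforced y' B oB (⊩A⊃B y' w≤y (occurs•⇒forced y' A oA))
      occurs∘⇒unforced w (□ A) o ⊩□A with happy∘ w (□ A) o
      ... | y , z , w≤y , yRz , oA =
        occurs∘⇒unforced (R-successor yRz) A oA
          (⊩□A (≤-successor w≤y) (R-successor yRz) w≤y yRz)
      occurs∘⇒unforced w (◇ A) o (u , wRu , ⊩A) =
        occurs∘⇒unforced u A (proj₁ (happy∘ w (◇ A) o (proj₁ u) wRu)) ⊩A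

mainTheorem2 : (G : Sequent) → Lab G → Happy G →
    IsBirelational (model G)
    × (∀ (w : Lab G) → Frame.R (model G) w w)
    × (∀ (u v w : Lab G) → Frame.R (model G) u v → Frame.R (model G) v w → Frame.R (model G) u w)
    × (∀ (w : Lab G) (A : Fm) → _∶_• G (proj₁ w) A → _⊩_ {model G} w A)
    × (∀ (w : Lab G) (A : Fm) → _∶_∘ G (proj₁ w) A → ¬ (_⊩_ {model G} w A))
mainTheorem2 G w (sat , happy) =
    model-isBirelational sat w
  , model-R-refl sat
  , model-R-trans sat
  , occurs•⇒forced sat happy
  , occurs∘⇒unforced sat happy
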